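{- Let $T\subset\mathbb{R}^3$ be the tetrahedron with vertices $(0,0,0)$, $\left(\frac12,0,0\right)$, $\left(0,2+\sqrt2,0\right)$ and $\left(0,0,2-\sqrt2\right)$. Then for every positive integer $t$, $$\#(tT\cap\mathbb{Z}^3)=\frac16t^3+t^2+\frac{11}{6}t+1.$$ -}

module Defs where

open import Data.Nat using (ℕ)
open import Data.Integer using (ℤ; +_; _+_; _-_; _*_; -_; _≤_; _<_; +0)
open import Data.Product using (_×_; _,_)
open import Data.Sum using (_⊎_)

-- The ring ℤ[√2]: a pair (a , b) stands for a + b·√2 ∈ ℝ.

record ℤ√2 : Set where
  constructor _+_√2
  field
    re : ℤ
    ir : ℤ
open ℤ√2 public

infixl 6 _⊕_ _⊖_
_⊕_ : ℤ√2 → ℤ√2 → ℤ√2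
(a + b √2) ⊕ (c + d √2) = (a + c) + (b + d) √2

_⊖_ : ℤ√2 → ℤ√2 → ℤ√2
(a + b √2) ⊖ (c + d √2) = (a - c) + (b - d) √2

infixl 7 _·_
infix 4 _≤√_
_·_ : ℤ → ℤ√2 → ℤ√2
k · (a + b √2) = (k * a) + (k * b) √2

ι : ℤ → ℤ√2
ι a = a + +0 √2

-- a + b√2 ≥ 0 (as a real number), decided exactly by sign/square comparisons
NonNeg : ℤ√2 → Set
NonNeg (a + b √2) =
    (+0 ≤ a × +0 ≤ b)
  ⊎ (+0 ≤ a × b < +0 × (+ 2) * (b * b) ≤ a * a)
  ⊎ (a < +0 × +0 < b × a * a ≤ (+ 2) * (b * b))

_≤√_ : ℤ√2 → ℤ√2 → Set
u ≤√ v = NonNeg (v ⊖ u)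

-- T = conv{0, (1/2,0,0), (0,2+√2,0), (0,0,2-√2)}
--   = { x,y,z ≥ 0 , 2x + y/(2+√2) + z/(2-√2) ≤ 1 }.
-- Since 1/(2+√2) = (2-√2)/2 and 1/(2-√2) = (2+√2)/2, multiplying by 2,
-- a point p lies in tT iff x,y,z ≥ 0 and 4x + (2-√2)y + (2+√2)z ≤ 2t.

InDilate : ℕ → ℤ × ℤ × ℤ → Set
InDilate t (x , y , z) =
  +0 ≤ x × +0 ≤ y × +0 ≤ z ×
  (((x · ι (+ 4)) ⊕ (y · ((+ 2) + (- (+ 1)) √2)) ⊕ (z · ((+ 2) + (+ 1) √2)))
     ≤√ ι ((+ 2) * (+ t)))

-- A lattice point (x, y, z) of tT satisfies 4x + 2y + 2z + z√2 ≤ 2t + y√2. Adding 1 to x, or 1 to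
-- both y and z, adds 4 to the left-hand side and leaves (y − z)√2 unchanged, so these shifts map the
-- lattice points of tT bijectively onto those of (t + 2)T with x ≥ 1, resp. onto those with x = 0 and
-- y, z ≥ 1. Hence #tT = #(t − 2)T + #S(t) and #S(t) = #S(t − 2) + #A(t), where S(t) is the slice x = 0
-- of tT and A(t) its points on the y- and z-axes. For y + z = 4t, (0, y, 0) ∈ tT iff y(2 − √2) ≤ 2t
-- and (0, 0, z) ∈ tT iff y(2 − √2) ≥ 2t; as √2 is irrational exactly one holds when t ≥ 1, so
-- #A(t) = 4t. Therefore #S(t) = (t + 1)² and #tT = (t + 1)(t + 2)(t + 3)/6.

module Submission where

open import Defs
open import Level using (0ℓ)
open import Data.Empty using (⊥-elim)
open import Data.Nat
  using (ℕ; zero; suc; pred; _+_; _*_; _∸_; _^_; _≤_; _<_; _≤?_; _<?_; z≤n; s≤s; s≤s⁻¹; >-nonZero)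
open import Data.Nat.Properties
open import Data.Nat.Divisibility using (divides)
open import Data.Nat.Primality using (euclidsLemma; prime[2])
open import Data.Nat.Induction using (<-rec)
open import Data.Nat.Tactic.RingSolver using (solve-∀; solve)
open import Data.Integer as ℤ using (ℤ; +_; -[1+_]; ∣_∣)
import Data.Integer.Properties as ℤ
open import Data.Integer.Tactic.RingSolver using () renaming (solve-∀ to ℤ-solve-∀)
open import Data.List using (List; []; _∷_; length; map; filter; _++_; applyUpTo; upTo)
open import Data.List.Properties using (length-map; length-++)
open import Data.List.Membership.Propositional using (_∈_)
open import Data.List.Membership.Propositional.Properties
  using ( ∈-map⁺; ∈-map⁻; ∈-filter⁺; ∈-filter⁻; ∈-++⁺ˡ; ∈-++⁺ʳ; ∈-++⁻
        ; ∈-applyUpTo⁺; ∈-applyUpTo⁻; ∈-upTo⁺; ∈-upTo⁻)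
open import Data.List.Relation.Unary.Any using (here)
import Data.List.Relation.Unary.All as All
open import Data.List.Relation.Unary.Unique.Propositional using (Unique; []; _∷_)
import Data.List.Relation.Unary.Unique.Propositional.Properties as Unique
open import Data.Product as Product using (Σ; ∃-syntax; _×_; _,_; proj₁; proj₂)
open import Data.Sum as Sum using (_⊎_; inj₁; inj₂)
open import Function using (_∘_; id; _∋_)
open import Function.Bundles using (_⇔_; mk⇔; Equivalence)
open import Function.Properties.Equivalence using (⇔-setoid) renaming (sym to ⇔-sym; trans to ⇔-trans)
open import Relation.Nullary using (¬_; Dec; yes; no; contradiction)
open import Relation.Nullary.Decidable using (_×-dec_; _⊎-dec_)
open import Relation.Unary using (Decidable)
open import Relation.Binary.PropositionalEquality
  using (_≡_; _≢_; refl; sym; trans; cong; cong₂; subst; subst₂; module ≡-Reasoning)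
import Relation.Binary.Reasoning.Setoid as SetoidReasoning

open Equivalence using (to; from)

private
  module ⇔-Reasoning = SetoidReasoning (⇔-setoid 0ℓ)

  variable
    A B C : Set

-- Irrationality of √2

halve-√2 : ∀ {m n} → m * m ≡ 2 * (n * n) → ∃[ a ] m ≡ a * 2 × n * n ≡ 2 * (a * a)
halve-√2 {m} {n} eq
  with divides a refl ← Sum.reduce (euclidsLemma m m prime[2] (divides (n * n) (trans eq (*-comm 2 (n * n)))))
  = a , refl , *-cancelˡ-≡ (n * n) (2 * (a * a)) 2 (trans (sym eq) (double-square a))
  where
  double-square : ∀ a → (a * 2) * (a * 2) ≡ 2 * (2 * (a * a))
  double-square = solve-∀

√2-irrational : ∀ m {n} → m * m ≡ 2 * (n * n) → m ≡ 0 × n ≡ 0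
√2-irrational = <-rec _ descend
  where
  descend : ∀ m → (∀ {k} → k < m → ∀ {n} → k * k ≡ 2 * (n * n) → k ≡ 0 × n ≡ 0) →
            ∀ {n} → m * m ≡ 2 * (n * n) → m ≡ 0 × n ≡ 0
  descend zero _ {zero} _ = refl , refl
  descend zero _ {suc n} ()
  -- Halving twice yields the smaller solution (m/2 , n/2).
  descend (suc m) rec {n} eq with halve-√2 {suc m} {n} eq
  ... | zero , () , _
  ... | suc a , m≡a*2 , eq′ with halve-√2 {n} {suc a} eq′
  ...   | b , _ , eq″ = contradiction (proj₁ (rec a<m {b} eq″)) λ ()
    where
    a<m : suc a < suc m
    a<m = subst (suc a <_) (sym m≡a*2) (m<m*n (suc a) 2 (s≤s (s≤s z≤n)))

-- Duplicate-free enumerations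

record Enumerates {A : Set} (P : A → Set) (xs : List A) : Set where
  constructor enumerates
  field
    unique  : Unique xs
    members : ∀ a → a ∈ xs ⇔ P a

enumerates-cong : ∀ {P Q : A → Set} {xs} → (∀ a → P a ⇔ Q a) → Enumerates P xs → Enumerates Q xs
enumerates-cong P⇔Q (enumerates xs! ∈⇔) = enumerates xs! λ a → ⇔-trans (∈⇔ a) (P⇔Q a)

enumerates-filter : ∀ {P Q : A → Set} (Q? : Decidable Q) {xs} →
  Enumerates P xs → Enumerates (λ a → P a × Q a) (filter Q? xs)
enumerates-filter Q? {xs} (enumerates xs! ∈⇔) = enumerates (Unique.filter⁺ Q? xs!) λ a → mk⇔
  (λ a∈ → let a∈xs , q = ∈-filter⁻ Q? {xs = xs} a∈ in to (∈⇔ a) a∈xs , q)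
  (λ (p , q) → ∈-filter⁺ Q? (from (∈⇔ a) p) q)

enumerates-map : ∀ {P : A → Set} {Q : B → Set} {f : A → B} {xs} →
  (∀ {a a′} → f a ≡ f a′ → a ≡ a′) → (∀ {a} → P a → Q (f a)) → (∀ {b} → Q b → ∃[ a ] f a ≡ b × P a) →
  Enumerates P xs → Enumerates Q (map f xs)
enumerates-map {Q = Q} {f} f-injective P⇒Q Q⇒P (enumerates xs! ∈⇔) =
  enumerates (Unique.map⁺ f-injective xs!) λ b → mk⇔
    (λ b∈ → let a , a∈ , b≡fa = ∈-map⁻ f b∈ in subst Q (sym b≡fa) (P⇒Q (to (∈⇔ a) a∈)))
    (λ q → let a , fa≡b , p = Q⇒P q in subst (_∈ map f _) fa≡b (∈-map⁺ f (from (∈⇔ a) p)))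

enumerates-++ : ∀ {P Q : A → Set} {xs ys} → Enumerates P xs → Enumerates Q ys → (∀ {a} → P a → ¬ Q a) →
  Enumerates (λ a → P a ⊎ Q a) (xs ++ ys)
enumerates-++ {xs = xs} (enumerates xs! ∈xs⇔) (enumerates ys! ∈ys⇔) disjoint = enumerates
  (Unique.++⁺ xs! ys! (λ (a∈xs , a∈ys) → disjoint (to (∈xs⇔ _) a∈xs) (to (∈ys⇔ _) a∈ys)))
  λ a → mk⇔ (Sum.map (to (∈xs⇔ a)) (to (∈ys⇔ a)) ∘ ∈-++⁻ xs)
            Sum.[ ∈-++⁺ˡ ∘ from (∈xs⇔ a) , ∈-++⁺ʳ xs ∘ from (∈ys⇔ a) ]

length-map-++ : (f : A → C) (g : B → C) (xs : List A) (ys : List B) →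
  length (map f xs ++ map g ys) ≡ length xs + length ys
length-map-++ f g xs ys = trans (length-++ (map f xs)) (cong₂ _+_ (length-map f xs) (length-map g ys))

length-filter-complementary : ∀ {P Q : A → Set} (P? : Decidable P) (Q? : Decidable Q) (f g : ℕ → A) n →
  (∀ {i} → i < n → (P (f i) ⊎ Q (g i)) × ¬ (P (f i) × Q (g i))) →
  length (filter P? (applyUpTo f n)) + length (filter Q? (applyUpTo g n)) ≡ n
length-filter-complementary P? Q? f g zero _ = refl
length-filter-complementary P? Q? f g (suc n) exactlyOne
  with length-filter-complementary P? Q? (f ∘ suc) (g ∘ suc) n (exactlyOne ∘ s≤s) | exactlyOne (s≤s z≤n)
... | ih | one , notBoth with P? (f 0) | Q? (g 0)
... | yes p  | yes q  = contradiction (p , q) notBoth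
... | yes _  | no _   = cong suc ih
... | no _   | yes _  = trans (+-suc _ _) (cong suc ih)
... | no ¬p  | no ¬q  = contradiction one Sum.[ ¬p , ¬q ]

enumerates-upTo : ∀ n → Enumerates (_< n) (upTo n)
enumerates-upTo n = enumerates (Unique.upTo⁺ n) λ _ → mk⇔ ∈-upTo⁻ ∈-upTo⁺

enumerates-countdown : ∀ n → Enumerates (λ y → 0 < y × y ≤ n) (applyUpTo (n ∸_) n)
enumerates-countdown n = enumerates (Unique.applyUpTo⁺₁ (n ∸_) n distinct) λ _ → mk⇔ bounds member
  where
  distinct : ∀ {i j} → i < j → j < n → n ∸ i ≢ n ∸ j
  distinct i<j j<n = <⇒≢ (∸-monoʳ-< i<j (<⇒≤ j<n)) ∘ sym
  bounds : ∀ {y} → y ∈ applyUpTo (n ∸_) n → 0 < y × y ≤ n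
  bounds y∈ with i , i<n , refl ← ∈-applyUpTo⁻ (n ∸_) y∈ = m<n⇒0<n∸m i<n , m∸n≤m n i
  member : ∀ {y} → 0 < y × y ≤ n → y ∈ applyUpTo (n ∸_) n
  member (0<y , y≤n) = subst (_∈ _) (m∸[m∸n]≡n y≤n) (∈-applyUpTo⁺ (n ∸_) (∸-monoʳ-< 0<y y≤n))

-- Comparing a + b√2 with c + d√2

infix 4 _≼_ _≼?_

-- (a , b) ≼ (c , d) says a + b√2 ≤ c + d√2, decided by comparing squares.
_≼_ : ℕ × ℕ → ℕ × ℕ → Set
(a , b) ≼ (c , d) =
    b ≤ d × (a ∸ c) * (a ∸ c) ≤ 2 * ((d ∸ b) * (d ∸ b))
  ⊎ d < b × a ≤ c × 2 * ((b ∸ d) * (b ∸ d)) ≤ (c ∸ a) * (c ∸ a)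

_≼?_ : ∀ u v → Dec (u ≼ v)
(a , b) ≼? (c , d) = (b ≤? d ×-dec _ ≤? _) ⊎-dec (d <? b ×-dec a ≤? c ×-dec _ ≤? _)

≼-+ : ∀ k {a b c d} → ((k + a , b) ≼ (k + c , d)) ⇔ ((a , b) ≼ (c , d))
≼-+ k {a} {c = c} rewrite [m+n]∸[m+o]≡n∸o k a c | [m+n]∸[m+o]≡n∸o k c a =
  mk⇔ (Sum.map₂ (Product.map₂ (Product.map₁ (+-cancelˡ-≤ k _ _))))
      (Sum.map₂ (Product.map₂ (Product.map₁ (+-monoʳ-≤ k))))

≼-suc : ∀ {a b c d} → ((a , suc b) ≼ (c , suc d)) ⇔ ((a , b) ≼ (c , d))
≼-suc = mk⇔ (Sum.map (Product.map₁ s≤s⁻¹) (Product.map₁ s≤s⁻¹))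
            (Sum.map (Product.map₁ s≤s) (Product.map₁ s≤s))

rational-≼ : ∀ {a c d} → ((a , 0) ≼ (c , d)) ⇔ ((a ∸ c) * (a ∸ c) ≤ 2 * (d * d))
rational-≼ = mk⇔ (λ { (inj₁ (_ , h)) → h ; (inj₂ (() , _)) }) (λ h → inj₁ (z≤n , h))

≼-rational : ∀ {a b c} → ((a , b) ≼ (c , 0)) ⇔ (a ≤ c × 2 * (b * b) ≤ (c ∸ a) * (c ∸ a))
≼-rational {a} {zero} {c} = mk⇔
  (λ { (inj₁ (_ , h)) → m∸n≡0⇒m≤n (square≡0 (n≤0⇒n≡0 h)) , z≤n ; (inj₂ (() , _)) })
  (λ (a≤c , _) → inj₁ (z≤n , subst (λ e → e * e ≤ 0) (sym (m≤n⇒m∸n≡0 a≤c)) z≤n))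
  where
  square≡0 : ∀ {e} → e * e ≡ 0 → e ≡ 0
  square≡0 {zero} _ = refl
≼-rational {b = suc b} = mk⇔ (λ { (inj₁ (() , _)) ; (inj₂ (_ , h)) → h }) (λ h → inj₂ (s≤s z≤n , h))

square-≤⇒≤ : ∀ {m n} → m * m ≤ n * n → m ≤ n
square-≤⇒≤ {m} {n} h with m ≤? n
... | yes m≤n = m≤n
... | no m≰n = contradiction h (<⇒≱ (*-mono-< (≰⇒> m≰n) (≰⇒> m≰n)))

-- e ≤ f√2 implies 2e ≤ 3f, as 2√2 ≤ 3.
twice≤thrice : ∀ {e f} → e * e ≤ 2 * (f * f) → 2 * e ≤ 3 * f
twice≤thrice {e} {f} h = square-≤⇒≤ (begin
  (2 * e) * (2 * e)  ≡⟨ solve (e ∷ []) ⟩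
  4 * (e * e)        ≤⟨ *-monoʳ-≤ 4 h ⟩
  4 * (2 * (f * f))  ≡⟨ solve (f ∷ []) ⟩
  8 * (f * f)        ≤⟨ *-monoˡ-≤ (f * f) (n≤1+n 8) ⟩
  9 * (f * f)        ≡⟨ solve (f ∷ []) ⟩
  (3 * f) * (3 * f)  ∎)
  where open ≤-Reasoning

≼⇒≤ : ∀ {a b c d} → (a , b) ≼ (c , d) → 2 * a ≤ 2 * c + 3 * d
≼⇒≤ {a} {b} {c} {d} (inj₁ (_ , h)) = begin
  2 * a               ≤⟨ *-monoʳ-≤ 2 (m≤n+m∸n a c) ⟩
  2 * (c + (a ∸ c))   ≡⟨ *-distribˡ-+ 2 c (a ∸ c) ⟩
  2 * c + 2 * (a ∸ c) ≤⟨ +-monoʳ-≤ (2 * c) (twice≤thrice {a ∸ c} {d ∸ b} h) ⟩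
  2 * c + 3 * (d ∸ b) ≤⟨ +-monoʳ-≤ (2 * c) (*-monoʳ-≤ 3 (m∸n≤m d b)) ⟩
  2 * c + 3 * d       ∎
  where open ≤-Reasoning
≼⇒≤ {c = c} {d} (inj₂ (_ , a≤c , _)) = ≤-trans (*-monoʳ-≤ 2 a≤c) (m≤m+n (2 * c) (3 * d))

-- Relation to the order of ℤ[√2]

private
  square : ∀ i → i ℤ.* i ≡ + (∣ i ∣ * ∣ i ∣)
  square (+ n)    = ℤ.+◃n≡+n (n * n)
  square -[1+ n ] = refl

  twice-square : ∀ i → + 2 ℤ.* (i ℤ.* i) ≡ + (2 * (∣ i ∣ * ∣ i ∣))
  twice-square i = trans (cong (+ 2 ℤ.*_) (square i)) (sym (ℤ.pos-* 2 (∣ i ∣ * ∣ i ∣)))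

  twice-square≤square⇔ : ∀ i j → (+ 2 ℤ.* (i ℤ.* i) ℤ.≤ j ℤ.* j) ⇔ (2 * (∣ i ∣ * ∣ i ∣) ≤ ∣ j ∣ * ∣ j ∣)
  twice-square≤square⇔ i j rewrite twice-square i | square j = mk⇔ ℤ.drop‿+≤+ ℤ.+≤+

  square≤twice-square⇔ : ∀ i j → (j ℤ.* j ℤ.≤ + 2 ℤ.* (i ℤ.* i)) ⇔ (∣ j ∣ * ∣ j ∣ ≤ 2 * (∣ i ∣ * ∣ i ∣))
  square≤twice-square⇔ i j rewrite twice-square i | square j = mk⇔ ℤ.drop‿+≤+ ℤ.+≤+

nonNeg-pos-pos : ∀ m n → NonNeg ((+ m) + (+ n) √2)
nonNeg-pos-pos _ _ = inj₁ (ℤ.+≤+ z≤n , ℤ.+≤+ z≤n)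

nonNeg-pos-neg : ∀ m n → 0 < n → NonNeg ((+ m) + (ℤ.- (+ n)) √2) ⇔ 2 * (n * n) ≤ m * m
nonNeg-pos-neg m (suc n) _ = mk⇔
  (λ { (inj₁ (_ , ()))
     ; (inj₂ (inj₁ (_ , _ , h))) → to (twice-square≤square⇔ -[1+ n ] (+ m)) h
     ; (inj₂ (inj₂ (ℤ.+<+ () , _))) })
  (λ h → inj₂ (inj₁ (ℤ.+≤+ z≤n , ℤ.-<+ , from (twice-square≤square⇔ -[1+ n ] (+ m)) h)))

nonNeg-neg-pos : ∀ m n → 0 < m → NonNeg ((ℤ.- (+ m)) + (+ n) √2) ⇔ m * m ≤ 2 * (n * n)
nonNeg-neg-pos (suc m) n _ = mk⇔
  (λ { (inj₁ (() , _))
     ; (inj₂ (inj₁ (() , _)))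
     ; (inj₂ (inj₂ (_ , _ , h))) → to (square≤twice-square⇔ (+ n) -[1+ m ]) h })
  (λ h → inj₂ (inj₂ (ℤ.-<+ , positive h , from (square≤twice-square⇔ (+ n) -[1+ m ]) h)))
  where
  positive : ∀ {n} → suc m * suc m ≤ 2 * (n * n) → + 0 ℤ.< + n
  positive {suc n} _ = ℤ.+<+ (s≤s z≤n)

¬nonNeg-neg-neg : ∀ m n → 0 < m → 0 < n → ¬ NonNeg ((ℤ.- (+ m)) + (ℤ.- (+ n)) √2)
¬nonNeg-neg-neg (suc m) (suc n) _ _ (inj₁ (() , _))
¬nonNeg-neg-neg (suc m) (suc n) _ _ (inj₂ (inj₁ (() , _)))
¬nonNeg-neg-neg (suc m) (suc n) _ _ (inj₂ (inj₂ (_ , () , _)))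

module _ {a b c d : ℕ} where

  ≼-≤≤ : a ≤ c → b ≤ d → (a , b) ≼ (c , d)
  ≼-≤≤ a≤c b≤d = inj₁ (b≤d , subst (λ e → e * e ≤ 2 * ((d ∸ b) * (d ∸ b))) (sym (m≤n⇒m∸n≡0 a≤c)) z≤n)

  ≼-≤> : a ≤ c → d < b → ((a , b) ≼ (c , d)) ⇔ (2 * ((b ∸ d) * (b ∸ d)) ≤ (c ∸ a) * (c ∸ a))
  ≼-≤> a≤c d<b = mk⇔
    (λ { (inj₁ (b≤d , _)) → contradiction b≤d (<⇒≱ d<b) ; (inj₂ (_ , _ , h)) → h })
    (λ h → inj₂ (d<b , a≤c , h))

  ≼->≤ : c < a → b ≤ d → ((a , b) ≼ (c , d)) ⇔ ((a ∸ c) * (a ∸ c) ≤ 2 * ((d ∸ b) * (d ∸ b)))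
  ≼->≤ c<a b≤d = mk⇔
    (λ { (inj₁ (_ , h)) → h ; (inj₂ (_ , a≤c , _)) → contradiction a≤c (<⇒≱ c<a) })
    (λ h → inj₁ (b≤d , h))

  ≼->> : c < a → d < b → ¬ (a , b) ≼ (c , d)
  ≼->> c<a d<b (inj₁ (b≤d , _))    = <⇒≱ d<b b≤d
  ≼->> c<a d<b (inj₂ (_ , a≤c , _)) = <⇒≱ c<a a≤c

-- Both sides are defined by the same case distinction on the signs of c − a and d − b.
nonNeg⇔≼ : ∀ a b c d → NonNeg ((c ℤ.⊖ a) + (d ℤ.⊖ b) √2) ⇔ ((a , b) ≼ (c , d))
nonNeg⇔≼ a b c d with a ≤? c | b ≤? d
... | yes a≤c | yes b≤d rewrite ℤ.⊖-≥ a≤c | ℤ.⊖-≥ b≤d =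
  mk⇔ (λ _ → ≼-≤≤ a≤c b≤d) (λ _ → nonNeg-pos-pos _ _)
... | yes a≤c | no b≰d rewrite ℤ.⊖-≥ a≤c | ℤ.⊖-< (≰⇒> b≰d) =
  ⇔-trans (nonNeg-pos-neg _ _ (m<n⇒0<n∸m (≰⇒> b≰d))) (⇔-sym (≼-≤> a≤c (≰⇒> b≰d)))
... | no a≰c | yes b≤d rewrite ℤ.⊖-< (≰⇒> a≰c) | ℤ.⊖-≥ b≤d =
  ⇔-trans (nonNeg-neg-pos _ _ (m<n⇒0<n∸m (≰⇒> a≰c))) (⇔-sym (≼->≤ (≰⇒> a≰c) b≤d))
... | no a≰c | no b≰d rewrite ℤ.⊖-< (≰⇒> a≰c) | ℤ.⊖-< (≰⇒> b≰d) =
  mk⇔ (⊥-elim ∘ ¬nonNeg-neg-neg _ _ (m<n⇒0<n∸m (≰⇒> a≰c)) (m<n⇒0<n∸m (≰⇒> b≰d)))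
      (⊥-elim ∘ ≼->> (≰⇒> a≰c) (≰⇒> b≰d))

-- Lattice points of tT

-- InDilate t rearranged to 4x + 2y + 2z + z√2 ≤ 2t + y√2, so that no subtraction occurs.
InDilateℕ : ℕ → ℕ × ℕ × ℕ → Set
InDilateℕ t (x , y , z) = (x * 4 + y * 2 + z * 2 , z) ≼ (t * 2 , y)

InDilateℕ? : ∀ t p → Dec (InDilateℕ t p)
InDilateℕ? t (x , y , z) = (x * 4 + y * 2 + z * 2 , z) ≼? (t * 2 , y)

InDilate⇔InDilateℕ : ∀ t x y z → InDilate t (+ x , + y , + z) ⇔ InDilateℕ t (x , y , z)
InDilate⇔InDilateℕ t x y z = mk⇔
  (λ (_ , _ , _ , h) → to (nonNeg⇔≼ _ z (t * 2) y) (subst NonNeg coordinates h))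
  (λ h → ℤ.+≤+ z≤n , ℤ.+≤+ z≤n , ℤ.+≤+ z≤n ,
         subst NonNeg (sym coordinates) (from (nonNeg⇔≼ _ z (t * 2) y) h))
  where
  rational-part : + 2 ℤ.* + t ℤ.- ((+ x ℤ.* + 4 ℤ.+ + y ℤ.* + 2) ℤ.+ + z ℤ.* + 2)
                ≡ (t * 2) ℤ.⊖ (x * 4 + y * 2 + z * 2)
  rational-part = begin
    + 2 ℤ.* + t ℤ.- ((+ x ℤ.* + 4 ℤ.+ + y ℤ.* + 2) ℤ.+ + z ℤ.* + 2)
      ≡⟨ cong₂ ℤ._-_ (trans (sym (ℤ.pos-* 2 t)) (cong +_ (*-comm 2 t))) (sym weight) ⟩
    + (t * 2) ℤ.- + (x * 4 + y * 2 + z * 2)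
      ≡⟨ ℤ.m-n≡m⊖n (t * 2) (x * 4 + y * 2 + z * 2) ⟩
    (t * 2) ℤ.⊖ (x * 4 + y * 2 + z * 2) ∎
    where
    open ≡-Reasoning
    weight : + (x * 4 + y * 2 + z * 2) ≡ + x ℤ.* + 4 ℤ.+ + y ℤ.* + 2 ℤ.+ + z ℤ.* + 2
    weight = trans (ℤ.pos-+ (x * 4 + y * 2) (z * 2))
      (cong₂ ℤ._+_ (trans (ℤ.pos-+ (x * 4) (y * 2)) (cong₂ ℤ._+_ (ℤ.pos-* x 4) (ℤ.pos-* y 2)))
                   (ℤ.pos-* z 2))

  irrational-part : + 0 ℤ.- ((+ x ℤ.* + 0 ℤ.+ + y ℤ.* ℤ.- + 1) ℤ.+ + z ℤ.* + 1) ≡ y ℤ.⊖ z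
  irrational-part = trans (collect (+ x) (+ y) (+ z)) (ℤ.m-n≡m⊖n y z)
    where
    collect : ∀ i j k → + 0 ℤ.- ((i ℤ.* + 0 ℤ.+ j ℤ.* ℤ.- + 1) ℤ.+ k ℤ.* + 1) ≡ j ℤ.- k
    collect = ℤ-solve-∀

  coordinates : ι (+ 2 ℤ.* + t)
                ⊖ ((+ x) · ι (+ 4) ⊕ (+ y) · ((+ 2) + (ℤ.- (+ 1)) √2) ⊕ (+ z) · ((+ 2) + (+ 1) √2))
              ≡ ((t * 2) ℤ.⊖ (x * 4 + y * 2 + z * 2)) + (y ℤ.⊖ z) √2
  coordinates = cong₂ _+_√2 rational-part irrational-part

InDilateℕ-sucˣ : ∀ t x y z → InDilateℕ (2 + t) (suc x , y , z) ⇔ InDilateℕ t (x , y , z)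
InDilateℕ-sucˣ _ _ _ _ = ≼-+ 4

InDilateℕ-sucʸᶻ : ∀ t x y z → InDilateℕ (2 + t) (x , suc y , suc z) ⇔ InDilateℕ t (x , y , z)
InDilateℕ-sucʸᶻ t x y z = begin
  InDilateℕ (2 + t) (x , suc y , suc z)
    ≡⟨ cong (λ a → (a , suc z) ≼ (4 + t * 2 , suc y)) (weight-suc x y z) ⟩
  (4 + (x * 4 + y * 2 + z * 2) , suc z) ≼ (4 + t * 2 , suc y)
    ≈⟨ ≼-suc ⟩
  (4 + (x * 4 + y * 2 + z * 2) , z) ≼ (4 + t * 2 , y)
    ≈⟨ ≼-+ 4 ⟩
  InDilateℕ t (x , y , z) ∎
  where
  open ⇔-Reasoning
  weight-suc : ∀ x y z → x * 4 + suc y * 2 + suc z * 2 ≡ 4 + (x * 4 + y * 2 + z * 2)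
  weight-suc = solve-∀

InDilateℕ⇒bound : ∀ {t x y z} → InDilateℕ t (x , y , z) → x * 8 + y + z * 4 ≤ t * 4
InDilateℕ⇒bound {t} {x} {y} {z} p =
  +-cancelʳ-≤ (y * 3) (x * 8 + y + z * 4) (t * 4) (subst₂ _≤_ (rearrange x y z) (rearrange′ t y) (≼⇒≤ p))
  where
  rearrange : ∀ x y z → 2 * (x * 4 + y * 2 + z * 2) ≡ x * 8 + y + z * 4 + y * 3
  rearrange = solve-∀
  rearrange′ : ∀ t y → 2 * (t * 2) + 3 * y ≡ t * 4 + y * 3
  rearrange′ = solve-∀

private
  5≤4t⇒2≤t : ∀ {t} → 5 ≤ t * 4 → 2 ≤ t
  5≤4t⇒2≤t {suc (suc t)} _ = s≤s (s≤s z≤n)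
  5≤4t⇒2≤t {suc zero} (s≤s (s≤s (s≤s (s≤s ()))))

InDilateℕ-sucˣ⇒2≤t : ∀ {t x y z} → InDilateℕ t (suc x , y , z) → 2 ≤ t
InDilateℕ-sucˣ⇒2≤t {t} {x} {y} {z} p =
  5≤4t⇒2≤t (≤-trans (s≤s (s≤s (s≤s (s≤s (s≤s z≤n))))) (InDilateℕ⇒bound {t} {suc x} {y} {z} p))

InDilateℕ-sucʸᶻ⇒2≤t : ∀ {t x y z} → InDilateℕ t (x , suc y , suc z) → 2 ≤ t
InDilateℕ-sucʸᶻ⇒2≤t {t} {x} {y} {z} p =
  5≤4t⇒2≤t (≤-trans (m≤m+n 5 (x * 8 + y + z * 4))
                     (subst (_≤ t * 4) (lhs x y z) (InDilateℕ⇒bound {t} {x} {suc y} {suc z} p)))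
  where
  lhs : ∀ x y z → x * 8 + suc y + suc z * 4 ≡ 5 + (x * 8 + y + z * 4)
  lhs = solve-∀

-- The axes of the plane x = 0

private
  +-cancelˡ-≤⇔ : ∀ k {m n} → (k + m ≤ k + n) ⇔ (m ≤ n)
  +-cancelˡ-≤⇔ k = mk⇔ (+-cancelˡ-≤ k _ _) (+-monoʳ-≤ k)

  2*-cancelˡ-≤⇔ : ∀ {m n} → (2 * m ≤ 2 * n) ⇔ (m ≤ n)
  2*-cancelˡ-≤⇔ = mk⇔ (*-cancelˡ-≤ 2) (*-monoʳ-≤ 2)

y-axis-bound : ∀ {t y} → InDilateℕ t (0 , y , 0) → y ≤ t * 4
y-axis-bound {t} {y} p = ≤-trans (m≤m+n y 0) (InDilateℕ⇒bound {t} {0} {y} {0} p)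

z-axis-bound : ∀ {t z} → InDilateℕ t (0 , 0 , z) → z ≤ t
z-axis-bound {t} {z} p = *-cancelʳ-≤ z t 4 (InDilateℕ⇒bound {t} {0} {0} {z} p)

-- as 3(2 − √2) ≤ 2
y-axis-below : ∀ {t y} → y ≤ t * 3 → InDilateℕ t (0 , y , 0)
y-axis-below {t} {y} y≤3t with y ≤? t
... | yes y≤t = from rational-≼ (subst (λ e → e * e ≤ 2 * (y * y)) (sym (m≤n⇒m∸n≡0 2y≤2t)) z≤n)
  where
  2y≤2t : y * 2 + 0 ≤ t * 2
  2y≤2t = ≤-trans (≤-reflexive (+-identityʳ (y * 2))) (*-monoˡ-≤ 2 y≤t)
... | no y≰t with d , refl ← m≤n⇒∃[o]m+o≡n (<⇒≤ (≰⇒> y≰t)) =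
  from rational-≼ (subst (λ e → e * e ≤ 2 * ((t + d) * (t + d))) (sym excess) (begin
    (d * 2) * (d * 2)
      ≡⟨ solve (d ∷ []) ⟩
    2 * (d * d) + 2 * (d * d)
      ≤⟨ +-monoʳ-≤ (2 * (d * d)) (*-monoʳ-≤ 2 (*-monoʳ-≤ d d≤2t)) ⟩
    2 * (d * d) + 2 * (d * (t * 2))
      ≤⟨ m≤m+n _ (2 * (t * t)) ⟩
    2 * (d * d) + 2 * (d * (t * 2)) + 2 * (t * t)
      ≡⟨ solve (t ∷ d ∷ []) ⟩
    2 * ((t + d) * (t + d)) ∎))
  where
  open ≤-Reasoning
  d≤2t : d ≤ t * 2
  d≤2t = +-cancelˡ-≤ t d (t * 2) (≤-trans y≤3t (≤-reflexive (solve (t ∷ []))))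
  excess : (t + d) * 2 + 0 ∸ t * 2 ≡ d * 2
  excess = trans (cong (_∸ t * 2) (split t d)) (m+n∸m≡n (t * 2) (d * 2))
    where
    split : ∀ t d → (t + d) * 2 + 0 ≡ t * 2 + d * 2
    split = solve-∀

-- With t = z + w and y = 3z + 4w both axis conditions compare z with w√2.
y-axis-param : ∀ z w → InDilateℕ (z + w) (0 , z * 3 + w * 4 , 0) ⇔ (2 * (w * w) ≤ z * z)
y-axis-param z w = begin
  InDilateℕ (z + w) (0 , y , 0)
    ≈⟨ rational-≼ ⟩
  (y * 2 + 0 ∸ (z + w) * 2) * (y * 2 + 0 ∸ (z + w) * 2) ≤ 2 * (y * y)
    ≡⟨ cong (λ e → e * e ≤ 2 * (y * y)) excess ⟩
  ((z * 2 + w * 3) * 2) * ((z * 2 + w * 3) * 2) ≤ 2 * (y * y)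
    ≡⟨ cong₂ _≤_ (excess² z w) (twice-y² z w) ⟩
  common + 2 * (2 * (w * w)) ≤ common + 2 * (z * z)
    ≈⟨ +-cancelˡ-≤⇔ common ⟩
  2 * (2 * (w * w)) ≤ 2 * (z * z)
    ≈⟨ 2*-cancelˡ-≤⇔ ⟩
  2 * (w * w) ≤ z * z ∎
  where
  open ⇔-Reasoning
  y common : ℕ
  y = z * 3 + w * 4
  common = 16 * (z * z) + 48 * (z * w) + 32 * (w * w)
  excess : y * 2 + 0 ∸ (z + w) * 2 ≡ (z * 2 + w * 3) * 2
  excess = trans (cong (_∸ (z + w) * 2) (split z w)) (m+n∸m≡n ((z + w) * 2) ((z * 2 + w * 3) * 2))
    where
    split : ∀ z w → (z * 3 + w * 4) * 2 + 0 ≡ (z + w) * 2 + (z * 2 + w * 3) * 2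
    split = solve-∀
  excess² : ∀ z w → ((z * 2 + w * 3) * 2) * ((z * 2 + w * 3) * 2)
                  ≡ 16 * (z * z) + 48 * (z * w) + 32 * (w * w) + 2 * (2 * (w * w))
  excess² = solve-∀
  twice-y² : ∀ z w → 2 * ((z * 3 + w * 4) * (z * 3 + w * 4))
                   ≡ 16 * (z * z) + 48 * (z * w) + 32 * (w * w) + 2 * (z * z)
  twice-y² = solve-∀

z-axis-param : ∀ z w → InDilateℕ (z + w) (0 , 0 , z) ⇔ (z * z ≤ 2 * (w * w))
z-axis-param z w = ⇔-trans ≼-rational (mk⇔ (to key ∘ proj₂) (λ h → z*2≤ , from key h))
  where
  z*2≤ : z * 2 ≤ (z + w) * 2
  z*2≤ = *-monoˡ-≤ 2 (m≤m+n z w)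
  excess : (z + w) * 2 ∸ z * 2 ≡ w * 2
  excess = trans (cong (_∸ z * 2) (*-distribʳ-+ 2 z w)) (m+n∸m≡n (z * 2) (w * 2))
  key : (2 * (z * z) ≤ ((z + w) * 2 ∸ z * 2) * ((z + w) * 2 ∸ z * 2)) ⇔ (z * z ≤ 2 * (w * w))
  key = begin
    2 * (z * z) ≤ ((z + w) * 2 ∸ z * 2) * ((z + w) * 2 ∸ z * 2) ≡⟨ cong (λ e → 2 * (z * z) ≤ e * e) excess ⟩
    2 * (z * z) ≤ (w * 2) * (w * 2)                               ≡⟨ cong (2 * (z * z) ≤_) (solve (w ∷ [])) ⟩
    2 * (z * z) ≤ 2 * (2 * (w * w))                               ≈⟨ 2*-cancelˡ-≤⇔ ⟩
    z * z ≤ 2 * (w * w)                                           ∎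
    where open ⇔-Reasoning

ExactlyOneOnAxes : ℕ → ℕ → ℕ → Set
ExactlyOneOnAxes t y z =
  (InDilateℕ t (0 , y , 0) ⊎ InDilateℕ t (0 , 0 , z)) × ¬ (InDilateℕ t (0 , y , 0) × InDilateℕ t (0 , 0 , z))

exactlyOneOnAxes-param : ∀ z w → 1 ≤ z + w → ExactlyOneOnAxes (z + w) (z * 3 + w * 4) z
exactlyOneOnAxes-param z w 1≤z+w =
  Sum.map (from (y-axis-param z w)) (from (z-axis-param z w)) (≤-total (2 * (w * w)) (z * z)) , neither
  where
  neither : ¬ (InDilateℕ (z + w) (0 , z * 3 + w * 4 , 0) × InDilateℕ (z + w) (0 , 0 , z))
  neither (onY , onZ) =
    let z≡0 , w≡0 = √2-irrational z {w} (≤-antisym (to (z-axis-param z w) onZ) (to (y-axis-param z w) onY))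
    in contradiction (subst (1 ≤_) (cong₂ _+_ z≡0 w≡0) 1≤z+w) λ ()

exactlyOneOnAxes : ∀ {t y z} → 1 ≤ t → y + z ≡ t * 4 → ExactlyOneOnAxes t y z
exactlyOneOnAxes {t} {y} {z} 1≤t y+z≡4t with z ≤? t
... | no z≰t = inj₁ (y-axis-below {t} y≤3t) , z≰t ∘ z-axis-bound {t} ∘ proj₂
  where
  open ≤-Reasoning
  y≤3t : y ≤ t * 3
  y≤3t = +-cancelʳ-≤ t y (t * 3) (begin
    y + t     ≤⟨ +-monoʳ-≤ y (<⇒≤ (≰⇒> z≰t)) ⟩
    y + z     ≡⟨ y+z≡4t ⟩
    t * 4     ≡⟨ *-suc t 3 ⟩
    t + t * 3 ≡⟨ +-comm t (t * 3) ⟩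
    t * 3 + t ∎)
... | yes z≤t with w , refl ← m≤n⇒∃[o]m+o≡n z≤t =
  subst (λ y → ExactlyOneOnAxes (z + w) y z) (sym y≡3z+4w) (exactlyOneOnAxes-param z w 1≤t)
  where
  y≡3z+4w : y ≡ z * 3 + w * 4
  y≡3z+4w = +-cancelʳ-≡ z y (z * 3 + w * 4) (trans y+z≡4t (distrib z w))
    where
    distrib : ∀ z w → (z + w) * 4 ≡ z * 3 + w * 4 + z
    distrib = solve-∀

-- Counting tT ∩ ℤ³

-- Both lists are indexed by i < 4t, with y = 4t − i in the first and z = i in the second,
-- so that exactlyOneOnAxes applies at every index; the origin is counted on the z-axis.
yAxis zAxis : ℕ → List ℕ
yAxis t = filter (λ y → InDilateℕ? t (0 , y , 0)) (applyUpTo (t * 4 ∸_) (t * 4))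
zAxis t = filter (λ z → InDilateℕ? t (0 , 0 , z)) (upTo (t * 4))

axes : ℕ → List (ℕ × ℕ)
axes t = map (_, 0) (yAxis t) ++ map (0 ,_) (zAxis t)

slice : ℕ → List (ℕ × ℕ)
slice zero          = (0 , 0) ∷ []
slice (suc zero)    = axes 1
slice (suc (suc t)) = map (Product.map suc suc) (slice t) ++ axes (2 + t)

inPlane : ℕ × ℕ → ℕ × ℕ × ℕ
inPlane q = 0 , q

points : ℕ → List (ℕ × ℕ × ℕ)
points zero          = map inPlane (slice 0)
points (suc zero)    = map inPlane (slice 1)
points (suc (suc t)) = map (Product.map₁ suc) (points t) ++ map inPlane (slice (2 + t))

OnAxes : ℕ → ℕ × ℕ → Set
OnAxes t (y , z) = (y ≡ 0 ⊎ z ≡ 0) × InDilateℕ t (0 , y , z)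

enumerates-axes : ∀ {t} → 1 ≤ t → Enumerates (OnAxes t) (axes t)
enumerates-axes {t} 1≤t =
  enumerates-cong onAxes (enumerates-++ onY onZ λ (0<y , _) (y≡0 , _) → <⇒≢ 0<y (sym y≡0))
  where
  OnY OnZ : ℕ × ℕ → Set
  OnY (y , z) = 0 < y × z ≡ 0 × InDilateℕ t (0 , y , z)
  OnZ (y , z) = y ≡ 0 × InDilateℕ t (0 , y , z)

  onY : Enumerates OnY (map (_, 0) (yAxis t))
  onY = enumerates-map (cong proj₁) (λ ((0<y , _) , p) → 0<y , refl , p)
    (λ { {y , _} (0<y , refl , p) → y , refl , (0<y , y-axis-bound {t} p) , p })
    (enumerates-filter _ (enumerates-countdown (t * 4)))

  onZ : Enumerates OnZ (map (0 ,_) (zAxis t))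
  onZ = enumerates-map (cong proj₂) (λ (_ , p) → refl , p)
    (λ { {_ , z} (refl , p) → z , refl , ≤-<-trans (z-axis-bound {t} p) t<4t , p })
    (enumerates-filter _ (enumerates-upTo (t * 4)))
    where
    t<4t : t < t * 4
    t<4t = m<m*n t 4 {{>-nonZero 1≤t}} (s≤s (s≤s z≤n))

  onAxes : ∀ q → (OnY q ⊎ OnZ q) ⇔ OnAxes t q
  onAxes (y , z) = mk⇔
    Sum.[ (λ (_ , z≡0 , p) → inj₂ z≡0 , p) , (λ (y≡0 , p) → inj₁ y≡0 , p) ]
    (λ { (inj₁ refl , p) → inj₂ (refl , p) ; (inj₂ refl , p) → onY-or-origin y p })
    where
    onY-or-origin : ∀ y → InDilateℕ t (0 , y , 0) → OnY (y , 0) ⊎ OnZ (y , 0)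
    onY-or-origin zero    p = inj₂ (refl , p)
    onY-or-origin (suc y) p = inj₁ (s≤s z≤n , refl , p)

length-axes : ∀ {t} → 1 ≤ t → length (axes t) ≡ t * 4
length-axes {t} 1≤t = trans (length-map-++ (_, 0) (0 ,_) (yAxis t) (zAxis t))
  (length-filter-complementary _ _ (t * 4 ∸_) id (t * 4)
    (λ i<4t → exactlyOneOnAxes 1≤t (m∸n+n≡m (<⇒≤ i<4t))))

enumerates-slice : ∀ t → Enumerates (λ (y , z) → InDilateℕ t (0 , y , z)) (slice t)
enumerates-slice zero =
  enumerates (All.[] ∷ []) λ _ → mk⇔ (λ { (here refl) → inj₁ (z≤n , z≤n) }) (here ∘ origin)
  where
  origin : ∀ {y z} → InDilateℕ 0 (0 , y , z) → (y , z) ≡ (0 , 0)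
  origin {zero}  {zero}  _ = refl
  origin {suc y} {z}     p with () ← InDilateℕ⇒bound {0} {0} {suc y} {z} p
  origin {zero}  {suc z} p with () ← InDilateℕ⇒bound {0} {0} {0} {suc z} p
enumerates-slice (suc zero) =
  enumerates-cong (λ (y , z) → mk⇔ proj₂ λ p → on-axes y z p , p) (enumerates-axes ≤-refl)
  where
  on-axes : ∀ y z → InDilateℕ 1 (0 , y , z) → y ≡ 0 ⊎ z ≡ 0
  on-axes zero    _       _ = inj₁ refl
  on-axes (suc _) zero    _ = inj₂ refl
  on-axes (suc y) (suc z) p = contradiction (InDilateℕ-sucʸᶻ⇒2≤t {1} {0} {y} {z} p) λ { (s≤s ()) }
enumerates-slice (suc (suc t)) =
  enumerates-cong split (enumerates-++ inner (enumerates-axes {2 + t} (s≤s z≤n)) disjoint)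
  where
  Inner : ℕ × ℕ → Set
  Inner (y , z) = 0 < y × 0 < z × InDilateℕ (2 + t) (0 , y , z)

  inner : Enumerates Inner (map (Product.map suc suc) (slice t))
  inner = enumerates-map (cong (Product.map pred pred))
    (λ {(y , z)} p → s≤s z≤n , s≤s z≤n , from (InDilateℕ-sucʸᶻ t 0 y z) p)
    (λ { {suc y , suc z} (_ , _ , p) → (y , z) , refl , to (InDilateℕ-sucʸᶻ t 0 y z) p })
    (enumerates-slice t)

  disjoint : ∀ {q} → Inner q → ¬ OnAxes (2 + t) q
  disjoint (0<y , _ , _) (inj₁ refl , _) = <-irrefl refl 0<y
  disjoint (_ , 0<z , _) (inj₂ refl , _) = <-irrefl refl 0<z

  split : ∀ q → (Inner q ⊎ OnAxes (2 + t) q) ⇔ InDilateℕ (2 + t) (0 , proj₁ q , proj₂ q)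
  split (y , z) = mk⇔ Sum.[ proj₂ ∘ proj₂ , proj₂ ] (classify y z)
    where
    classify : ∀ y z → InDilateℕ (2 + t) (0 , y , z) → Inner (y , z) ⊎ OnAxes (2 + t) (y , z)
    classify zero    _       p = inj₂ (inj₁ refl , p)
    classify (suc _) zero    p = inj₂ (inj₂ refl , p)
    classify (suc _) (suc _) p = inj₁ (s≤s z≤n , s≤s z≤n , p)

length-slice : ∀ t → length (slice t) ≡ suc t * suc t
length-slice zero          = refl
length-slice (suc zero)    = length-axes ≤-refl
length-slice (suc (suc t)) = begin
  length (map (Product.map suc suc) (slice t) ++ axes (2 + t))
    ≡⟨ length-++ (map (Product.map suc suc) (slice t)) ⟩
  length (map (Product.map suc suc) (slice t)) + length (axes (2 + t))
    ≡⟨ cong₂ _+_ (trans (length-map (Product.map suc suc) (slice t)) (length-slice t))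
                 (length-axes {2 + t} (s≤s z≤n)) ⟩
  suc t * suc t + (2 + t) * 4
    ≡⟨ square-step t ⟩
  (3 + t) * (3 + t) ∎
  where
  open ≡-Reasoning
  square-step : ∀ t → suc t * suc t + (2 + t) * 4 ≡ (3 + t) * (3 + t)
  square-step = solve-∀

enumerates-plane : ∀ t → Enumerates (λ (x , y , z) → x ≡ 0 × InDilateℕ t (x , y , z)) (map inPlane (slice t))
enumerates-plane t =
  enumerates-map (cong proj₂) (refl ,_) (λ { {_ , q} (refl , p) → q , refl , p }) (enumerates-slice t)

only-plane : ∀ t → t < 2 → ∀ p → (proj₁ p ≡ 0 × InDilateℕ t p) ⇔ InDilateℕ t p
only-plane t t<2 (x , y , z) = mk⇔ proj₂ λ p → x≡0 x p , p
  where
  x≡0 : ∀ x → InDilateℕ t (x , y , z) → x ≡ 0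
  x≡0 zero    _ = refl
  x≡0 (suc x) p = contradiction (InDilateℕ-sucˣ⇒2≤t {t} {x} {y} {z} p) (<⇒≱ t<2)

enumerates-points : ∀ t → Enumerates (InDilateℕ t) (points t)
enumerates-points zero          = enumerates-cong (only-plane 0 (s≤s z≤n)) (enumerates-plane 0)
enumerates-points (suc zero)    = enumerates-cong (only-plane 1 ≤-refl) (enumerates-plane 1)
enumerates-points (suc (suc t)) =
  enumerates-cong split
    (enumerates-++ shifted (enumerates-plane (2 + t)) λ (0<x , _) (x≡0 , _) → <⇒≢ 0<x (sym x≡0))
  where
  Shifted : ℕ × ℕ × ℕ → Set
  Shifted (x , y , z) = 0 < x × InDilateℕ (2 + t) (x , y , z)

  shifted : Enumerates Shifted (map (Product.map₁ suc) (points t))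
  shifted = enumerates-map (cong (Product.map₁ pred))
    (λ {(x , y , z)} p → s≤s z≤n , from (InDilateℕ-sucˣ t x y z) p)
    (λ { {suc x , y , z} (_ , p) → (x , y , z) , refl , to (InDilateℕ-sucˣ t x y z) p })
    (enumerates-points t)

  split : ∀ p → (Shifted p ⊎ (proj₁ p ≡ 0 × InDilateℕ (2 + t) p)) ⇔ InDilateℕ (2 + t) p
  split (x , y , z) = mk⇔ Sum.[ proj₂ , proj₂ ] (classify x)
    where
    classify : ∀ x → InDilateℕ (2 + t) (x , y , z) →
               Shifted (x , y , z) ⊎ (x ≡ 0 × InDilateℕ (2 + t) (x , y , z))
    classify zero    p = inj₂ (refl , p)
    classify (suc _) p = inj₁ (s≤s z≤n , p)

length-points : ∀ t → 6 * length (points t) ≡ t ^ 3 + 6 * t ^ 2 + 11 * t + 6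
length-points zero          = refl
length-points (suc zero)    =
  cong (6 *_) (length (points 1) ≡ 4 ∋ trans (length-map inPlane (slice 1)) (length-slice 1))
length-points (suc (suc t)) = begin
  6 * length (map (Product.map₁ suc) (points t) ++ map inPlane (slice (2 + t)))
    ≡⟨ cong (6 *_) (length-map-++ (Product.map₁ suc) inPlane (points t) (slice (2 + t))) ⟩
  6 * (length (points t) + length (slice (2 + t)))
    ≡⟨ *-distribˡ-+ 6 (length (points t)) _ ⟩
  6 * length (points t) + 6 * length (slice (2 + t))
    ≡⟨ cong₂ _+_ (length-points t) (cong (6 *_) (length-slice (2 + t))) ⟩
  t ^ 3 + 6 * t ^ 2 + 11 * t + 6 + 6 * ((3 + t) * (3 + t))
    ≡⟨ cubic-step t ⟩
  (2 + t) ^ 3 + 6 * (2 + t) ^ 2 + 11 * (2 + t) + 6 ∎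
  where
  open ≡-Reasoning
  cubic-step : ∀ t → t ^ 3 + 6 * t ^ 2 + 11 * t + 6 + 6 * ((3 + t) * (3 + t))
                   ≡ (2 + t) ^ 3 + 6 * (2 + t) ^ 2 + 11 * (2 + t) + 6
  cubic-step = expanded
    where
    expanded : ∀ t → t * (t * (t * 1)) + 6 * (t * (t * 1)) + 11 * t + 6 + 6 * ((3 + t) * (3 + t))
                   ≡ (2 + t) * ((2 + t) * ((2 + t) * 1)) + 6 * ((2 + t) * ((2 + t) * 1)) + 11 * (2 + t) + 6
    expanded = solve-∀

embed : ℕ × ℕ × ℕ → ℤ × ℤ × ℤ
embed (x , y , z) = + x , + y , + z

enumerates-InDilate : ∀ t → Enumerates (InDilate t) (map embed (points t))
enumerates-InDilate t = enumerates-map (cong (Product.map ∣_∣ (Product.map ∣_∣ ∣_∣)))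
  (λ {(x , y , z)} → from (InDilate⇔InDilateℕ t x y z)) natural (enumerates-points t)
  where
  natural : ∀ {q} → InDilate t q → ∃[ p ] embed p ≡ q × InDilateℕ t p
  natural {+ x , + y , + z} q∈ = (x , y , z) , refl , to (InDilate⇔InDilateℕ t x y z) q∈
  natural { -[1+ _ ] , _ , _} (() , _)
  natural {+ _ , -[1+ _ ] , _} (_ , () , _)
  natural {+ _ , + _ , -[1+ _ ]} (_ , _ , () , _)

proposition3p4 : (t : ℕ) → 1 ≤ t →
    Σ (List (ℤ × ℤ × ℤ)) (λ L →
      Unique L
      × ((p : ℤ × ℤ × ℤ) → (p ∈ L) ⇔ InDilate t p)
      × 6 * length L ≡ t ^ 3 + 6 * t ^ 2 + 11 * t + 6)
proposition3p4 t _ =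
  map embed (points t) , unique , members ,
  trans (cong (6 *_) (length-map embed (points t))) (length-points t)
  where open Enumerates (enumerates-InDilate t)
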